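{- Let $G$ be a finite commutative group with $|G|=q$. Let $k\ge 2$ and $l\ge 0$ be integers and let $A\subseteq G$ be a set whose representation function satisfies $r(x)\le k$ if $x\notin 2\cdot A$ and $r(x)\le k+l$ if $x\in 2\cdot A$. Then $$|A|<\sqrt{(k-1)q}+1+\frac{l}{2}+\frac{l(l+1)}{2(k-1)}.$$
   Context: For $A\subseteq G$, the representation function is $r(x)=\#\{(a_1,a_2): a_1,a_2\in A,\ a_1+a_2=x\}$ (ordered pairs), and $2\cdot A=\{2a: a\in A\}$. -}

module Defs where

open import Data.Nat using (ℕ; _*_; _+_; _∸_)
open import Data.Bool using (Bool; _∧_)
open import Data.Fin using (Fin)
open import Data.Fin.Properties using (_≟_)
open import Data.Fin.Subset using (Subset; _∈_; ∣_∣)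
open import Data.Vec using (lookup)
open import Data.List using (List; length; filterᵇ; cartesianProduct; allFin)
open import Data.Product using (_×_; _,_; ∃-syntax)
open import Relation.Nullary.Decidable using (⌊_⌋)
open import Relation.Binary.PropositionalEquality using (_≡_)
open import Data.Integer using (ℤ; +_; _-_; _<_; 0ℤ)
  renaming (_*_ to _*ℤ_)
open import Data.Sum using (_⊎_)

-- A finite commutative group of order q is modelled (up to isomorphism) as
-- a group structure on Fin q; its operation is passed as _·_.

-- representation function: number of ORDERED pairs (a₁ , a₂) ∈ A × A with a₁ · a₂ = x
r : ∀ {q} → (Fin q → Fin q → Fin q) → Subset q → Fin q → ℕ
r {q} _·_ A x = length (filterᵇ good (cartesianProduct (allFin q) (allFin q)))
  where
  good : Fin q × Fin q → Bool
  good (a₁ , a₂) = lookup A a₁ ∧ lookup A a₂ ∧ ⌊ (a₁ · a₂) ≟ x ⌋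

_∈2·_ : ∀ {q} → Fin q → (Fin q → Fin q → Fin q) × Subset q → Set
_∈2·_ {q} x (_·_ , A) = ∃[ a ] (a ∈ A × (a · a) ≡ x)

-- The bound |A| < √((k-1)q) + 1 + l/2 + l(l+1)/(2(k-1)), cleared of denominators:
-- with D = 2(k-1) and N = D|A| - (D + l(k-1) + l(l+1)) the bound is  N < D √((k-1)q),
-- i.e.  N < 0  or  N² < D² (k-1) q.
Bound : (q k l a : ℕ) → Set
Bound q k l a = N < 0ℤ ⊎ (N *ℤ N) < + (D * D * (k ∸ 1) * q)
  where
  D = 2 * (k ∸ 1)
  N = (+ (D * a)) - (+ (D + l * (k ∸ 1) + l * (l + 1)))

-- Write a = |A|, E = ∑ₓ r(x)² for the additive energy of A and
-- D(y) = #{(i , j) ∈ A² : i - j = y} for the difference counts.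
--  (1) E counts quadruples with k + l = i + j; these correspond to the
--      quadruples with l - j = i - k, so E = ∑_y D(y)², while ∑_y D(y) = a²
--      and D(0) = a.
--  (2) Cauchy–Schwarz over the q - 1 elements y ≠ 0: (a² - a)² ≤ (q - 1)(E - a²).
--  (3) r(x)² ≤ k r(x) + l(k + l) t(x), where t(x) = #{b ∈ A : 2b = x} is
--      positive on 2·A; summing over x gives E ≤ k a² + l(k + l) a.
--  (4) Dividing by a and completing the square yields the bound, in the
--      denominator-free form Bound of Defs.

module Submission where

open import Defs
open import Data.Nat using (ℕ; _≤_; _+_)
open import Data.Fin using (Fin)
open import Data.Fin.Subset using (Subset; ∣_∣)
open import Data.Product using (_,_)
open import Relation.Nullary using (¬_)
open import Relation.Binary.PropositionalEquality using (_≡_)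
open import Algebra.Structures using (IsAbelianGroup)

open import Algebra.Bundles using (AbelianGroup)
open import Data.Bool using (Bool; true; false; not; _∧_)
open import Data.Fin using (zero; suc)
open import Data.Fin.Properties using (_≟_; any?)
open import Data.Fin.Subset.Properties using (_∈?_)
import Data.Integer as ℤ
open import Data.Integer using (0ℤ)
open import Data.Integer.Properties using ([+m]-[+n]≡m⊖n; ⊖-<; ⊖-≥; pos-*)
open import Data.List using (List; length; filterᵇ; cartesianProduct; map; tabulate; _++_)
open import Data.List.Properties using (length-++; filter-++; map-tabulate)
open import Data.Nat using (zero; suc; _*_; _∸_; _<_; _<?_; z≤n; s≤s; z<s)
open import Data.Nat.Properties hiding (_≟_)
open import Data.Nat.Tactic.RingSolver using (solve-∀)
open import Data.Product using (_×_)
open import Data.Sum using (inj₁; inj₂)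
open import Data.Vec using ([]; _∷_; lookup)
open import Data.Vec.Properties using ([]=⇒lookup)
open import Function using (_∘_; id)
open import Level using (0ℓ)
open import Relation.Binary.PropositionalEquality
  using (refl; sym; trans; cong; cong₂; subst; subst₂; module ≡-Reasoning)
open import Relation.Nullary.Decidable using (Dec; does; yes; no; ⌊_⌋; T?; _×-dec_)
open import Relation.Nullary.Negation using (contradiction)
open import Algebra.Properties.Semiring.Sum +-*-semiring
  using (sum; sum-syntax; sum-cong-≗; ∑-distrib-+; ∑-comm; *-distribˡ-sum; *-distribʳ-sum;
         sum-remove; sum-replicate-zero)

𝟙 : Bool → ℕ
𝟙 true  = 1
𝟙 false = 0

𝟙-∧ : ∀ b c → 𝟙 (b ∧ c) ≡ 𝟙 b * 𝟙 c
𝟙-∧ true  c = sym (+-identityʳ (𝟙 c))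
𝟙-∧ false c = refl

𝟙-idem : ∀ b → 𝟙 b * 𝟙 b ≡ 𝟙 b
𝟙-idem true  = refl
𝟙-idem false = refl

δ : ∀ {n} → Fin n → Fin n → ℕ
δ x y = 𝟙 (does (x ≟ y))

δ-cong : ∀ {m n} {x y : Fin m} {z w : Fin n} →
         (x ≡ y → z ≡ w) → (z ≡ w → x ≡ y) → δ x y ≡ δ z w
δ-cong {x = x} {y} {z} {w} to from with x ≟ y | z ≟ w
... | yes _   | yes _   = refl
... | no  _   | no  _   = refl
... | yes x≡y | no  z≢w = contradiction (to x≡y) z≢w
... | no  x≢y | yes z≡w = contradiction (from z≡w) x≢y

δ-self : ∀ {n} (x : Fin n) → δ x x ≡ 1
δ-self x with x ≟ x
... | yes _   = refl
... | no  x≢x = contradiction refl x≢x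

sum-mono-≤ : ∀ {n} {f g : Fin n → ℕ} → (∀ i → f i ≤ g i) → sum f ≤ sum g
sum-mono-≤ {zero}  f≤g = z≤n
sum-mono-≤ {suc n} f≤g = +-mono-≤ (f≤g zero) (sum-mono-≤ (f≤g ∘ suc))

term≤sum : ∀ {n} (f : Fin n → ℕ) (i : Fin n) → f i ≤ sum f
term≤sum {suc n} f i = ≤-trans (m≤m+n (f i) _) (≤-reflexive (sym (sum-remove {i = i} f)))

sum-ones : ∀ n → ∑[ i < n ] 1 ≡ n
sum-ones zero    = refl
sum-ones (suc n) = cong suc (sum-ones n)

sum-δ : ∀ {n} (y : Fin n) (g : Fin n → ℕ) → ∑[ x < n ] (δ y x * g x) ≡ g y
sum-δ {suc n} zero    g =
  trans (cong₂ _+_ (+-identityʳ (g zero)) (sum-replicate-zero n)) (+-identityʳ (g zero))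
sum-δ {suc n} (suc y) g = sum-δ y (g ∘ suc)

sum-δ-one : ∀ {n} (y : Fin n) → ∑[ x < n ] δ y x ≡ 1
sum-δ-one y = trans (sum-cong-≗ (λ x → sym (*-identityʳ (δ y x)))) (sum-δ y (λ _ → 1))

δᶜ : ∀ {n} → Fin n → Fin n → ℕ
δᶜ x y = 𝟙 (not (does (x ≟ y)))

δ+δᶜ : ∀ {n} (x y : Fin n) → δ x y + δᶜ x y ≡ 1
δ+δᶜ x y with does (x ≟ y)
... | true  = refl
... | false = refl

sum-except : ∀ {n} (y : Fin n) (g : Fin n → ℕ) → sum g ≡ g y + ∑[ x < n ] (δᶜ y x * g x)
sum-except {n} y g = begin
  sum g                                                ≡⟨ sum-cong-≗ split ⟩
  ∑[ x < n ] (δ y x * g x + δᶜ y x * g x)              ≡⟨ ∑-distrib-+ (λ x → δ y x * g x) _ ⟩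
  ∑[ x < n ] (δ y x * g x) + ∑[ x < n ] (δᶜ y x * g x) ≡⟨ cong (_+ ∑[ x < n ] (δᶜ y x * g x)) (sum-δ y g) ⟩
  g y + ∑[ x < n ] (δᶜ y x * g x)                      ∎
  where
  open ≡-Reasoning
  split : ∀ x → g x ≡ δ y x * g x + δᶜ y x * g x
  split x = begin
    g x                         ≡⟨ *-identityˡ (g x) ⟨
    1 * g x                     ≡⟨ cong (_* g x) (δ+δᶜ y x) ⟨
    (δ y x + δᶜ y x) * g x      ≡⟨ *-distribʳ-+ (g x) (δ y x) (δᶜ y x) ⟩
    δ y x * g x + δᶜ y x * g x  ∎

count-except : ∀ {n} (y : Fin n) → suc (∑[ x < n ] δᶜ y x) ≡ n
count-except {n} y = begin
  suc (∑[ x < n ] δᶜ y x)           ≡⟨ cong suc (sum-cong-≗ (λ x → *-identityʳ (δᶜ y x))) ⟨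
  suc (∑[ x < n ] (δᶜ y x * 1))     ≡⟨ sum-except y (λ _ → 1) ⟨
  ∑[ x < n ] 1                      ≡⟨ sum-ones n ⟩
  n                                 ∎
  where open ≡-Reasoning

sum-*-sum : ∀ {n} (f g : Fin n → ℕ) → sum f * sum g ≡ ∑[ i < n ] ∑[ j < n ] (f i * g j)
sum-*-sum f g = trans (*-distribʳ-sum (sum g) f) (sum-cong-≗ (λ i → *-distribˡ-sum (f i) g))

am-gm-≤ : ∀ {x y} → x ≤ y → 2 * (x * y) ≤ x * x + y * y
am-gm-≤ {x} x≤y with m≤n⇒∃[o]m+o≡n x≤y
... | t , refl = subst (2 * (x * (x + t)) ≤_) (square-gap x t) (m≤m+n _ (t * t))
  where
  square-gap : ∀ x t → 2 * (x * (x + t)) + t * t ≡ x * x + (x + t) * (x + t)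
  square-gap = solve-∀

am-gm : ∀ x y → 2 * (x * y) ≤ x * x + y * y
am-gm x y with ≤-total x y
... | inj₁ x≤y = am-gm-≤ x≤y
... | inj₂ y≤x = subst₂ _≤_ (cong (2 *_) (*-comm y x)) (+-comm (y * y) (x * x)) (am-gm-≤ y≤x)

*-distribˡ-∑∑ : ∀ {m n} c (F : Fin m → Fin n → ℕ) →
                c * ∑[ i < m ] ∑[ j < n ] F i j ≡ ∑[ i < m ] ∑[ j < n ] (c * F i j)
*-distribˡ-∑∑ {m} {n} c F =
  trans (*-distribˡ-sum c (λ i → ∑[ j < n ] F i j)) (sum-cong-≗ (λ i → *-distribˡ-sum c (F i)))

∑∑-distrib-+ : ∀ {m n} (F G : Fin m → Fin n → ℕ) →
               ∑[ i < m ] ∑[ j < n ] (F i j + G i j) ≡ ∑[ i < m ] ∑[ j < n ] F i j + ∑[ i < m ] ∑[ j < n ] G i j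
∑∑-distrib-+ {m} {n} F G = trans (sum-cong-≗ (λ i → ∑-distrib-+ (F i) (G i)))
  (∑-distrib-+ (λ i → ∑[ j < n ] F i j) (λ i → ∑[ j < n ] G i j))

∑-comm₃ : ∀ {m n p} (F : Fin m → Fin n → Fin p → ℕ) →
          ∑[ x < m ] ∑[ i < n ] ∑[ j < p ] F x i j ≡ ∑[ i < n ] ∑[ j < p ] ∑[ x < m ] F x i j
∑-comm₃ {m} {n} {p} F =
  trans (∑-comm (λ x i → ∑[ j < p ] F x i j)) (sum-cong-≗ (λ i → ∑-comm (λ x j → F x i j)))

sum-fibres : ∀ {m n} (g : Fin m → Fin n) (f : Fin m → ℕ) →
             ∑[ x < n ] ∑[ i < m ] (f i * δ (g i) x) ≡ sum f
sum-fibres {m} {n} g f = trans (∑-comm (λ x i → f i * δ (g i) x)) (sum-cong-≗ λ i → begin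
  ∑[ x < n ] (f i * δ (g i) x)  ≡⟨ *-distribˡ-sum (f i) (δ (g i)) ⟨
  f i * ∑[ x < n ] δ (g i) x    ≡⟨ cong (f i *_) (sum-δ-one (g i)) ⟩
  f i * 1                       ≡⟨ *-identityʳ (f i) ⟩
  f i                           ∎)
  where open ≡-Reasoning

-- The weighted Cauchy–Schwarz inequality (∑ wᵢfᵢ)² ≤ (∑ wᵢ)(∑ wᵢfᵢ²):
-- symmetrise the double sum of wᵢwⱼfᵢfⱼ and apply am-gm to each term.
cauchy-schwarz : ∀ {n} (w f : Fin n → ℕ) →
  (∑[ i < n ] (w i * f i)) * (∑[ i < n ] (w i * f i)) ≤ sum w * ∑[ i < n ] (w i * (f i * f i))
cauchy-schwarz {n} w f = *-cancelˡ-≤ 2 (begin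
  2 * (S * S)                                        ≡⟨ cong (2 *_) (sum-*-sum wf wf) ⟩
  2 * ∑[ i < n ] ∑[ j < n ] (wf i * wf j)            ≡⟨ *-distribˡ-∑∑ 2 (λ i j → wf i * wf j) ⟩
  ∑[ i < n ] ∑[ j < n ] (2 * (wf i * wf j))          ≤⟨ sum-mono-≤ (λ i → sum-mono-≤ (λ j → symmetrised i j)) ⟩
  ∑[ i < n ] ∑[ j < n ] (w i * wff j + w j * wff i)  ≡⟨ ∑∑-distrib-+ (λ i j → w i * wff j) (λ i j → w j * wff i) ⟩
  ∑[ i < n ] ∑[ j < n ] (w i * wff j) + ∑[ i < n ] ∑[ j < n ] (w j * wff i)
                                                     ≡⟨ cong (∑[ i < n ] ∑[ j < n ] (w i * wff j) +_) (∑-comm (λ i j → w j * wff i)) ⟩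
  ∑[ i < n ] ∑[ j < n ] (w i * wff j) + ∑[ j < n ] ∑[ i < n ] (w j * wff i)
                                                     ≡⟨ cong₂ _+_ (sum-*-sum w wff) (sum-*-sum w wff) ⟨
  W * T + W * T                                      ≡⟨ cong (W * T +_) (+-identityʳ (W * T)) ⟨
  2 * (W * T)                                        ∎)
  where
  open ≤-Reasoning
  wf wff : Fin n → ℕ
  wf i = w i * f i
  wff i = w i * (f i * f i)
  S W T : ℕ
  S = sum wf
  W = sum w
  T = sum wff
  symmetrised : ∀ i j → 2 * (wf i * wf j) ≤ w i * wff j + w j * wff i
  symmetrised i j = subst₂ _≤_ (lhs (w i) (w j) (f i) (f j)) (rhs (w i) (w j) (f i) (f j))
                      (*-monoʳ-≤ (w i * w j) (am-gm (f i) (f j)))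
    where
    lhs : ∀ a b x y → a * b * (2 * (x * y)) ≡ 2 * (a * x * (b * y))
    lhs = solve-∀
    rhs : ∀ a b x y → a * b * (x * x + y * y) ≡ a * (b * (y * y)) + b * (a * (x * x))
    rhs = solve-∀

count-tabulate : ∀ {A : Set} {n} (p : A → Bool) (g : Fin n → A) →
                 length (filterᵇ p (tabulate g)) ≡ ∑[ i < n ] 𝟙 (p (g i))
count-tabulate {n = zero}  p g = refl
count-tabulate {n = suc n} p g with p (g zero)
... | true  = cong suc (count-tabulate p (g ∘ suc))
... | false = count-tabulate p (g ∘ suc)

count-grid : ∀ {A B : Set} {m n} (p : A × B → Bool) (g : Fin m → A) (h : Fin n → B) →
             length (filterᵇ p (cartesianProduct (tabulate g) (tabulate h)))
               ≡ ∑[ i < m ] ∑[ j < n ] 𝟙 (p (g i , h j))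
count-grid {m = zero}  p g h = refl
count-grid {A} {B} {suc m} p g h = begin
  length (filterᵇ p (row ++ rest))                        ≡⟨ cong length (filter-++ (T? ∘ p) row rest) ⟩
  length (filterᵇ p row ++ filterᵇ p rest)                ≡⟨ length-++ (filterᵇ p row) ⟩
  length (filterᵇ p row) + length (filterᵇ p rest)        ≡⟨ cong₂ _+_ row-count (count-grid p (g ∘ suc) h) ⟩
  ∑[ j < _ ] 𝟙 (p (g zero , h j)) + ∑[ i < m ] ∑[ j < _ ] 𝟙 (p (g (suc i) , h j)) ∎
  where
  open ≡-Reasoning
  row rest : List (A × B)
  row  = map (g zero ,_) (tabulate h)
  rest = cartesianProduct (tabulate (g ∘ suc)) (tabulate h)
  row-count : length (filterᵇ p row) ≡ ∑[ j < _ ] 𝟙 (p (g zero , h j))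
  row-count = trans (cong (length ∘ filterᵇ p) (map-tabulate h (g zero ,_))) (count-tabulate p (λ j → g zero , h j))

-- Representation counts and additive energy of a weighted operation

module Representations {m n} (h : Fin m → Fin m → Fin n) (f : Fin m → ℕ) where

  rep : Fin n → ℕ
  rep x = ∑[ i < m ] ∑[ j < m ] (f i * (f j * δ (h i j) x))

  energy : ℕ
  energy = ∑[ i < m ] ∑[ j < m ] ∑[ k < m ] ∑[ l < m ] (f i * (f j * (f k * (f l * δ (h k l) (h i j)))))

  private
    factor-pair : ∀ i j (G : Fin n → ℕ) → ∑[ x < n ] (f i * (f j * G x)) ≡ f i * (f j * sum G)
    factor-pair i j G = sym (trans (cong (f i *_) (*-distribˡ-sum (f j) G)) (*-distribˡ-sum (f i) (λ x → f j * G x)))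

  -- Every pair (i , j) is counted at exactly one x, so the counts add up to (∑ f)².
  rep-total : ∑[ x < n ] rep x ≡ sum f * sum f
  rep-total = begin
    ∑[ x < n ] rep x                                             ≡⟨ ∑-comm₃ (λ x i j → f i * (f j * δ (h i j) x)) ⟩
    ∑[ i < m ] ∑[ j < m ] ∑[ x < n ] (f i * (f j * δ (h i j) x)) ≡⟨ sum-cong-≗ (λ i → sum-cong-≗ (λ j → one-point i j)) ⟩
    ∑[ i < m ] ∑[ j < m ] (f i * f j)                            ≡⟨ sum-*-sum f f ⟨
    sum f * sum f                                                ∎
    where
    open ≡-Reasoning
    one-point : ∀ i j → ∑[ x < n ] (f i * (f j * δ (h i j) x)) ≡ f i * f j
    one-point i j = begin
      ∑[ x < n ] (f i * (f j * δ (h i j) x)) ≡⟨ factor-pair i j (δ (h i j)) ⟩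
      f i * (f j * ∑[ x < n ] δ (h i j) x)   ≡⟨ cong (λ c → f i * (f j * c)) (sum-δ-one (h i j)) ⟩
      f i * (f j * 1)                        ≡⟨ cong (f i *_) (*-identityʳ (f j)) ⟩
      f i * f j                              ∎

  sum-rep² : ∑[ x < n ] (rep x * rep x) ≡ energy
  sum-rep² = begin
    ∑[ x < n ] (rep x * rep x)
      ≡⟨ sum-cong-≗ expand ⟩
    ∑[ x < n ] ∑[ i < m ] ∑[ j < m ] (f i * (f j * (δ (h i j) x * rep x)))
      ≡⟨ ∑-comm₃ (λ x i j → f i * (f j * (δ (h i j) x * rep x))) ⟩
    ∑[ i < m ] ∑[ j < m ] ∑[ x < n ] (f i * (f j * (δ (h i j) x * rep x)))
      ≡⟨ sum-cong-≗ (λ i → sum-cong-≗ (λ j → sift i j)) ⟩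
    ∑[ i < m ] ∑[ j < m ] (f i * (f j * rep (h i j)))
      ≡⟨ sum-cong-≗ (λ i → sum-cong-≗ (λ j → unfold i j)) ⟩
    energy
      ∎
    where
    open ≡-Reasoning
    expand : ∀ x → rep x * rep x ≡ ∑[ i < m ] ∑[ j < m ] (f i * (f j * (δ (h i j) x * rep x)))
    expand x = trans (*-distribʳ-sum (rep x) (λ i → ∑[ j < m ] (f i * (f j * δ (h i j) x))))
      (sum-cong-≗ (λ i → trans (*-distribʳ-sum (rep x) (λ j → f i * (f j * δ (h i j) x)))
        (sum-cong-≗ (λ j → trans (*-assoc (f i) (f j * δ (h i j) x) (rep x))
                                 (cong (f i *_) (*-assoc (f j) (δ (h i j) x) (rep x)))))))
    sift : ∀ i j → ∑[ x < n ] (f i * (f j * (δ (h i j) x * rep x))) ≡ f i * (f j * rep (h i j))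
    sift i j = trans (factor-pair i j (λ x → δ (h i j) x * rep x)) (cong (λ c → f i * (f j * c)) (sum-δ (h i j) rep))
    unfold : ∀ i j → f i * (f j * rep (h i j))
                     ≡ ∑[ k < m ] ∑[ l < m ] (f i * (f j * (f k * (f l * δ (h k l) (h i j)))))
    unfold i j = trans (cong (f i *_) (*-distribˡ-∑∑ (f j) (λ k l → f k * (f l * δ (h k l) (h i j)))))
                       (*-distribˡ-∑∑ (f i) (λ k l → f j * (f k * (f l * δ (h k l) (h i j)))))

-- Sums versus differences in a finite abelian group

module Differences {q} {_·_ : Fin q → Fin q → Fin q} {e : Fin q} {inv : Fin q → Fin q}
                   (G : IsAbelianGroup _≡_ _·_ e inv) where

  open IsAbelianGroup G using (assoc; comm; inverseʳ)
  open IsAbelianGroup G public using (_-_)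
  open Representations using (rep; energy)

  abelianGroup : AbelianGroup 0ℓ 0ℓ
  abelianGroup = record
    { Carrier = Fin q ; _≈_ = _≡_ ; _∙_ = _·_ ; ε = e ; _⁻¹ = inv ; isAbelianGroup = G }

  open import Algebra.Properties.AbelianGroup abelianGroup
    using (//-rightDividesˡ; //-rightDividesʳ; x∙y⁻¹≈ε⇒x≈y)

  -‿swap : ∀ x u v → x - u - v ≡ x - v - u
  -‿swap x u v = begin
    x - u - v            ≡⟨ assoc x (inv u) (inv v) ⟩
    x · (inv u · inv v)  ≡⟨ cong (x ·_) (comm (inv u) (inv v)) ⟩
    x · (inv v · inv u)  ≡⟨ assoc x (inv v) (inv u) ⟨
    x - v - u            ∎
    where open ≡-Reasoning

  cross-multiply : ∀ {a b c d} → a - b ≡ c - d → a · d ≡ c · b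
  cross-multiply {a} {b} {c} {d} eq = begin
    a · d              ≡⟨ cong (_· d) (//-rightDividesˡ b a) ⟨
    ((a - b) · b) · d  ≡⟨ assoc (a - b) b d ⟩
    (a - b) · (b · d)  ≡⟨ cong₂ _·_ eq (comm b d) ⟩
    (c - d) · (d · b)  ≡⟨ assoc (c - d) d b ⟨
    ((c - d) · d) · b  ≡⟨ cong (_· b) (//-rightDividesˡ d c) ⟩
    c · b              ∎
    where open ≡-Reasoning

  uncross : ∀ {a b c d} → a · d ≡ c · b → a - b ≡ c - d
  uncross {a} {b} {c} {d} eq = begin
    a - b            ≡⟨ cong (_- b) (//-rightDividesʳ d a) ⟨
    (a · d) - d - b  ≡⟨ -‿swap (a · d) d b ⟩
    (a · d) - b - d  ≡⟨ cong (λ z → z - b - d) eq ⟩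
    (c · b) - b - d  ≡⟨ cong (_- d) (//-rightDividesʳ b c) ⟩
    c - d            ∎
    where open ≡-Reasoning

  -- The additive energy of A equals its difference energy: the quadruples with
  -- k + l = i + j correspond to those with l - j = i - k.
  energy-sums≡differences : (f : Fin q → ℕ) → energy _·_ f ≡ energy _-_ f
  energy-sums≡differences f = begin
    energy _·_ f
      ≡⟨ sum-cong-≗ (λ i → trans (∑-comm (λ j k → ∑[ l < q ] term i j k l))
                                 (sum-cong-≗ (λ k → ∑-comm (λ j l → term i j k l)))) ⟩
    ∑[ i < q ] ∑[ k < q ] ∑[ l < q ] ∑[ j < q ] term i j k l
      ≡⟨ sum-cong-≗ (λ i → sum-cong-≗ (λ k → sum-cong-≗ (λ l → sum-cong-≗ (λ j → rename i j k l)))) ⟩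
    energy _-_ f
      ∎
    where
    open ≡-Reasoning
    term : Fin q → Fin q → Fin q → Fin q → ℕ
    term i j k l = f i * (f j * (f k * (f l * δ (k · l) (i · j))))
    reorder : ∀ a b c d x → a * (b * (c * (d * x))) ≡ a * (c * (d * (b * x)))
    reorder = solve-∀
    coincide : ∀ i j k l → δ (k · l) (i · j) ≡ δ (l - j) (i - k)
    coincide i j k l = δ-cong (λ kl≡ij → uncross (trans (comm l k) kl≡ij))
                              (λ eq → trans (comm k l) (cross-multiply eq))
    rename : ∀ i j k l → term i j k l ≡ f i * (f k * (f l * (f j * δ (l - j) (i - k))))
    rename i j k l = trans (reorder (f i) (f j) (f k) (f l) _)
                           (cong (λ x → f i * (f k * (f l * (f j * x)))) (coincide i j k l))

  rep-difference-at-e : (f : Fin q → ℕ) → rep _-_ f e ≡ ∑[ i < q ] (f i * f i)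
  rep-difference-at-e f = sum-cong-≗ λ i → begin
    ∑[ j < q ] (f i * (f j * δ (i - j) e))  ≡⟨ sum-cong-≗ (λ j → cong (f i *_) (diagonal i j)) ⟩
    ∑[ j < q ] (f i * (δ i j * f j))         ≡⟨ *-distribˡ-sum (f i) (λ j → δ i j * f j) ⟨
    f i * ∑[ j < q ] (δ i j * f j)           ≡⟨ cong (f i *_) (sum-δ i f) ⟩
    f i * f i                                ∎
    where
    open ≡-Reasoning
    diagonal : ∀ i j → f j * δ (i - j) e ≡ δ i j * f j
    diagonal i j = trans (*-comm (f j) _)
                         (cong (_* f j) (δ-cong (x∙y⁻¹≈ε⇒x≈y i j) (λ { refl → inverseʳ i })))

  nontrivial-differences : (f : Fin q → ℕ) →
    ∑[ y < q ] (δᶜ e y * rep _-_ f y) + ∑[ i < q ] (f i * f i) ≡ sum f * sum f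
  nontrivial-differences f = begin
    ∑[ y < q ] (δᶜ e y * D y) + ∑[ i < q ] (f i * f i) ≡⟨ cong (∑[ y < q ] (δᶜ e y * D y) +_) (rep-difference-at-e f) ⟨
    ∑[ y < q ] (δᶜ e y * D y) + D e                    ≡⟨ +-comm _ (D e) ⟩
    D e + ∑[ y < q ] (δᶜ e y * D y)                    ≡⟨ sum-except e D ⟨
    ∑[ y < q ] D y                                     ≡⟨ Representations.rep-total _-_ f ⟩
    sum f * sum f                                      ∎
    where
    open ≡-Reasoning
    D : Fin q → ℕ
    D = rep _-_ f

  nontrivial-energy : (f : Fin q → ℕ) →
    ∑[ y < q ] (δᶜ e y * (rep _-_ f y * rep _-_ f y)) + ∑[ i < q ] (f i * f i) * ∑[ i < q ] (f i * f i)
      ≡ energy _·_ f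
  nontrivial-energy f = begin
    ∑[ y < q ] (δᶜ e y * D² y) + ∑[ i < q ] (f i * f i) * ∑[ i < q ] (f i * f i)
                                        ≡⟨ cong (∑[ y < q ] (δᶜ e y * D² y) +_) (cong₂ _*_ (rep-difference-at-e f) (rep-difference-at-e f)) ⟨
    ∑[ y < q ] (δᶜ e y * D² y) + D² e   ≡⟨ +-comm _ (D² e) ⟩
    D² e + ∑[ y < q ] (δᶜ e y * D² y)   ≡⟨ sum-except e D² ⟨
    ∑[ y < q ] D² y                     ≡⟨ Representations.sum-rep² _-_ f ⟩
    energy _-_ f                        ≡⟨ energy-sums≡differences f ⟨
    energy _·_ f                        ∎
    where
    open ≡-Reasoning
    D² : Fin q → ℕ
    D² y = rep _-_ f y * rep _-_ f y

χ : ∀ {q} → Subset q → Fin q → ℕ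
χ A i = 𝟙 (lookup A i)

∣A∣≡∑χ : ∀ {q} (A : Subset q) → ∣ A ∣ ≡ sum (χ A)
∣A∣≡∑χ []          = refl
∣A∣≡∑χ (true  ∷ A) = cong suc (∣A∣≡∑χ A)
∣A∣≡∑χ (false ∷ A) = ∣A∣≡∑χ A

χ-idem : ∀ {q} (A : Subset q) → ∑[ i < q ] (χ A i * χ A i) ≡ sum (χ A)
χ-idem A = sum-cong-≗ (λ i → 𝟙-idem (lookup A i))

-- Defs tests equality with ⌊_⌋, which agrees with does.
𝟙-isYes : ∀ {P : Set} (d : Dec P) → 𝟙 ⌊ d ⌋ ≡ 𝟙 (does d)
𝟙-isYes (yes _) = refl
𝟙-isYes (no  _) = refl

r≡rep : ∀ {q} (_·_ : Fin q → Fin q → Fin q) (A : Subset q) x →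
        r _·_ A x ≡ Representations.rep _·_ (χ A) x
r≡rep {q} _·_ A x =
  trans (count-grid (λ (i , j) → lookup A i ∧ lookup A j ∧ ⌊ (i · j) ≟ x ⌋) id id)
        (sum-cong-≗ λ i → sum-cong-≗ λ j → begin
  𝟙 (lookup A i ∧ lookup A j ∧ ⌊ (i · j) ≟ x ⌋)     ≡⟨ 𝟙-∧ (lookup A i) _ ⟩
  χ A i * 𝟙 (lookup A j ∧ ⌊ (i · j) ≟ x ⌋)         ≡⟨ cong (χ A i *_) (𝟙-∧ (lookup A j) _) ⟩
  χ A i * (χ A j * 𝟙 ⌊ (i · j) ≟ x ⌋)              ≡⟨ cong (λ c → χ A i * (χ A j * c)) (𝟙-isYes ((i · j) ≟ x)) ⟩
  χ A i * (χ A j * δ (i · j) x)                    ∎)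
  where open ≡-Reasoning

-- The hypothesis on r bounds the energy

square≤-small : ∀ {R k} c → R ≤ k → R * R ≤ k * R + c
square≤-small {R} c R≤k = ≤-trans (*-monoˡ-≤ R R≤k) (m≤m+n _ c)

square≤-large : ∀ {R k l t} → R ≤ k + l → 1 ≤ t → R * R ≤ k * R + l * (k + l) * t
square≤-large {R} {k} {l} {t} R≤k+l 1≤t = begin
  R * R                    ≤⟨ *-monoˡ-≤ R R≤k+l ⟩
  (k + l) * R              ≡⟨ *-distribʳ-+ R k l ⟩
  k * R + l * R            ≤⟨ +-monoʳ-≤ (k * R) (*-monoʳ-≤ l R≤k+l) ⟩
  k * R + l * (k + l)      ≡⟨ cong (k * R +_) (*-identityʳ (l * (k + l))) ⟨
  k * R + l * (k + l) * 1  ≤⟨ +-monoʳ-≤ (k * R) (*-monoʳ-≤ (l * (k + l)) 1≤t) ⟩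
  k * R + l * (k + l) * t  ∎
  where open ≤-Reasoning

_∈2·?_ : ∀ {q} (x : Fin q) (opA : (Fin q → Fin q → Fin q) × Subset q) → Dec (x ∈2· opA)
x ∈2·? (_·_ , A) = any? (λ a → (a ∈? A) ×-dec ((a · a) ≟ x))

-- Summing the pointwise bounds: the energy of A is at most k|A|² + l(k + l)|A|,
-- since the number of doubles a + a summing to x has total |A|.
energy-upper-bound : ∀ {q} (_·_ : Fin q → Fin q → Fin q) (A : Subset q) (k l : ℕ) →
  (∀ x → ¬ (x ∈2· (_·_ , A)) → r _·_ A x ≤ k) →
  (∀ x → x ∈2· (_·_ , A) → r _·_ A x ≤ k + l) →
  Representations.energy _·_ (χ A) ≤ k * (sum (χ A) * sum (χ A)) + l * (k + l) * sum (χ A)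
energy-upper-bound {q} _·_ A k l small large = begin
  energy                                          ≡⟨ sum-rep² ⟨
  ∑[ x < q ] (rep x * rep x)                      ≤⟨ sum-mono-≤ pointwise ⟩
  ∑[ x < q ] (k * rep x + L * doubles x)          ≡⟨ ∑-distrib-+ (λ x → k * rep x) (λ x → L * doubles x) ⟩
  ∑[ x < q ] (k * rep x) + ∑[ x < q ] (L * doubles x)
                                                  ≡⟨ cong₂ _+_ (*-distribˡ-sum k rep) (*-distribˡ-sum L doubles) ⟨
  k * ∑[ x < q ] rep x + L * ∑[ x < q ] doubles x ≡⟨ cong₂ (λ u v → k * u + L * v) rep-total (sum-fibres (λ i → i · i) (χ A)) ⟩
  k * (sum (χ A) * sum (χ A)) + L * sum (χ A)     ∎
  where
  open ≤-Reasoning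
  open Representations _·_ (χ A)
  L : ℕ
  L = l * (k + l)
  doubles : Fin q → ℕ
  doubles x = ∑[ i < q ] (χ A i * δ (i · i) x)
  pointwise : ∀ x → rep x * rep x ≤ k * rep x + L * doubles x
  pointwise x with x ∈2·? (_·_ , A)
  ... | no  x∉2A = square≤-small _ (subst (_≤ k) (r≡rep _·_ A x) (small x x∉2A))
  ... | yes x∈2A@(b , b∈A , refl) =
    square≤-large {k = k} {l = l} (subst (_≤ k + l) (r≡rep _·_ A x) (large x x∈2A))
                  (subst (_≤ doubles x) b-counted (term≤sum (λ i → χ A i * δ (i · i) x) b))
    where
    b-counted : χ A b * δ (b · b) (b · b) ≡ 1
    b-counted rewrite []=⇒lookup b∈A | δ-self (b · b) = refl

-- Arithmetic: from the counting estimates to the bound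

-- With a = u + 1 and P = a² - a, the estimate P² ≤ q' (E - a²) with
-- E ≤ (m + 1)a² + La becomes, after dividing by a, a u² ≤ q' (m a + L).
divide-by-a : ∀ {m u q' P Qd L} (let a = suc u) →
  P + a ≡ a * a → Qd + a * a ≤ suc m * (a * a) + L * a → P * P ≤ q' * Qd →
  a * u * u ≤ q' * (m * a + L)
divide-by-a {m} {u} {q'} {P} {Qd} {L} P+a≡a² Qd+a²≤ P²≤ = *-cancelˡ-≤ a (begin
  a * (a * u * u)            ≡⟨ square-of-P a u ⟩
  (u * a) * (u * a)          ≡⟨ cong (λ z → z * z) P≡ua ⟨
  P * P                      ≤⟨ P²≤ ⟩
  q' * Qd                    ≤⟨ *-monoʳ-≤ q' Qd≤ ⟩
  q' * (m * (a * a) + L * a) ≡⟨ factor-a a m L q' ⟩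
  a * (q' * (m * a + L))     ∎)
  where
  open ≤-Reasoning
  a : ℕ
  a = suc u
  P≡ua : P ≡ u * a
  P≡ua = +-cancelʳ-≡ a P (u * a) (trans P+a≡a² (+-comm a (u * a)))
  Qd≤ : Qd ≤ m * (a * a) + L * a
  Qd≤ = +-cancelˡ-≤ (a * a) _ _ (subst₂ _≤_ (+-comm Qd (a * a)) (+-assoc (a * a) _ _) Qd+a²≤)
  square-of-P : ∀ a u → a * (a * u * u) ≡ (u * a) * (u * a)
  square-of-P = solve-∀
  factor-a : ∀ a m L q' → q' * (m * (a * a) + L * a) ≡ a * (q' * (m * a + L))
  factor-a = solve-∀

-- Completing the square: with X = m a + L, n + L = 2mu and a u² ≤ q' X we get
-- n² X ≤ m a (n + L)² < 4m³ (a u² + X) ≤ 4m³ (q' + 1) X, hence n² < 4m³ (q' + 1).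
square-bound : ∀ {m' u q' L n} (let m = suc m') (let a = suc u) →
  a * u * u ≤ q' * (m * a + L) → n + L ≡ 2 * m * u →
  n * n < 2 * m * (2 * m) * m * suc q'
square-bound {m'} {u} {q'} {L} {n} au²≤ n+L≡2mu = *-cancelʳ-< X (n * n) _ (begin-strict
  n * n * X                                       ≡⟨ expand-X m a n L ⟩
  m * a * (n * n) + n * n * L                     ≤⟨ +-monoʳ-≤ (m * a * (n * n)) (*-monoˡ-≤ L (*-monoˡ-≤ n n≤2ma)) ⟩
  Z                                               <⟨ m<m+n Z (<-≤-trans 0<4m³X (m≤n+m _ (m * a * L * L))) ⟩
  Z + (m * a * L * L + 4 * m * m * m * X)         ≡⟨ complete-square m a n L ⟩
  m * a * ((n + L) * (n + L)) + 4 * m * m * m * X ≡⟨ cong (λ z → m * a * (z * z) + 4 * m * m * m * X) n+L≡2mu ⟩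
  m * a * ((2 * m * u) * (2 * m * u)) + 4 * m * m * m * X
                                                  ≡⟨ collect m a u L ⟩
  4 * m * m * m * (a * u * u + X)                 ≤⟨ *-monoʳ-≤ (4 * m * m * m) (+-monoˡ-≤ X au²≤) ⟩
  4 * m * m * m * (q' * X + X)                    ≡⟨ regroup m q' X ⟩
  2 * m * (2 * m) * m * suc q' * X                ∎)
  where
  open ≤-Reasoning
  m a X Z : ℕ
  m = suc m'
  a = suc u
  X = m * a + L
  Z = m * a * (n * n) + 2 * m * a * n * L
  0<4m³X : 0 < 4 * m * m * m * X
  0<4m³X = z<s
  n≤2ma : n ≤ 2 * m * a
  n≤2ma = ≤-trans (m≤m+n n L) (subst (_≤ 2 * m * a) (sym n+L≡2mu) (*-monoʳ-≤ (2 * m) (n≤1+n u)))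
  expand-X : ∀ m a n L → n * n * (m * a + L) ≡ m * a * (n * n) + n * n * L
  expand-X = solve-∀
  complete-square : ∀ m a n L →
    m * a * (n * n) + 2 * m * a * n * L + (m * a * L * L + 4 * m * m * m * (m * a + L))
      ≡ m * a * ((n + L) * (n + L)) + 4 * m * m * m * (m * a + L)
  complete-square = solve-∀
  collect : ∀ m a u L → m * a * ((2 * m * u) * (2 * m * u)) + 4 * m * m * m * (m * a + L)
                        ≡ 4 * m * m * m * (a * u * u + (m * a + L))
  collect = solve-∀
  regroup : ∀ m q' X → 4 * m * m * m * (q' * X + X) ≡ 2 * m * (2 * m) * m * suc q' * X
  regroup = solve-∀

difference-negative : ∀ {x y} → x < y → ℤ.+ x ℤ.- ℤ.+ y ℤ.< 0ℤ
difference-negative {x} {y} x<y =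
  subst (ℤ._< 0ℤ) (sym (trans ([+m]-[+n]≡m⊖n x y) (⊖-< x<y))) (negated-positive (m<n⇒0<n∸m x<y))
  where
  negated-positive : ∀ {z} → 0 < z → ℤ.- ℤ.+ z ℤ.< 0ℤ
  negated-positive {suc z} _ = ℤ.-<+

-- The bound of the theorem for |A| = a, from the three counting estimates
-- P + a = a², Qd + a² ≤ k a² + l(k + l)a and P² ≤ q' Qd: writing
-- N = 2(k - 1)a - (2(k - 1) + l(k - 1) + l(l + 1)), either N < 0, or
-- N = n ≥ 0 with n + l(k + l) = 2(k - 1)(a - 1) and square-bound applies.
bound-from-counts : ∀ {q' k l a P Qd} → 2 ≤ k →
  P + a ≡ a * a → Qd + a * a ≤ k * (a * a) + l * (k + l) * a → P * P ≤ q' * Qd →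
  Bound (suc q') k l a
bound-from-counts {k = suc (suc m')} {l} {zero} (s≤s (s≤s z≤n)) _ _ _ =
  inj₁ (difference-negative (subst (_< 2 * m + l * m + l * (l + 1)) (sym (*-zeroʳ (2 * m))) z<s))
  where
  m : ℕ
  m = suc m'
bound-from-counts {q'} {suc (suc m')} {l} {suc u} {P} {Qd} (s≤s (s≤s z≤n)) P+a≡a² Qd+a²≤ P²≤
  with 2 * suc m' * suc u <? 2 * suc m' + l * suc m' + l * (l + 1)
... | yes x<y = inj₁ (difference-negative x<y)
... | no  x≮y = inj₂ (subst (ℤ._< ℤ.+ (2 * m * (2 * m) * m * suc q')) (sym N²≡n²) (ℤ.+<+ n²<))
  where
  m L x y n : ℕ
  m = suc m'
  L = l * (suc m + l)
  x = 2 * m * suc u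
  y = 2 * m + l * m + l * (l + 1)
  n = x ∸ y
  y≤x : y ≤ x
  y≤x = ≮⇒≥ x≮y
  N²≡n² : (ℤ.+ x ℤ.- ℤ.+ y) ℤ.* (ℤ.+ x ℤ.- ℤ.+ y) ≡ ℤ.+ (n * n)
  N²≡n² = trans (cong (λ z → z ℤ.* z) (trans ([+m]-[+n]≡m⊖n x y) (⊖-≥ y≤x))) (sym (pos-* n n))
  regroup : ∀ n m l → n + l * (suc m + l) + 2 * m ≡ n + (2 * m + l * m + l * (l + 1))
  regroup = solve-∀
  n+L≡2mu : n + L ≡ 2 * m * u
  n+L≡2mu = +-cancelʳ-≡ (2 * m) _ _ (begin
    n + L + 2 * m                 ≡⟨ regroup n m l ⟩
    n + y                         ≡⟨ +-comm n y ⟩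
    y + n                         ≡⟨ m+[n∸m]≡n y≤x ⟩
    2 * m * suc u                 ≡⟨ *-suc (2 * m) u ⟩
    2 * m + 2 * m * u             ≡⟨ +-comm (2 * m) _ ⟩
    2 * m * u + 2 * m             ∎)
    where open ≡-Reasoning
  n²< : n * n < 2 * m * (2 * m) * m * suc q'
  n²< = square-bound {m'} {u} {q'} {L} {n}
          (divide-by-a {m} {u} {q'} {P} {Qd} {L} P+a≡a² Qd+a²≤ P²≤) n+L≡2mu

-- The theorem: apply bound-from-counts to the nontrivial differences D y, y ≠ e,
-- of A, whose number of values is q - 1.  Their total is |A|² - |A|, their
-- squares add up to E - |A|² for the energy E ≤ k|A|² + l(k + l)|A|, and
-- Cauchy–Schwarz relates the two.
theorem3 : (q : ℕ) (_·_ : Fin q → Fin q → Fin q) (e : Fin q) (inv : Fin q → Fin q)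
    → IsAbelianGroup _≡_ _·_ e inv
    → (k l : ℕ) → 2 ≤ k
    → (A : Subset q)
    → (∀ x → ¬ (x ∈2· (_·_ , A)) → r _·_ A x ≤ k)
    → (∀ x → x ∈2· (_·_ , A) → r _·_ A x ≤ k + l)
    → Bound q k l ∣ A ∣
theorem3 q _·_ e inv G k l 2≤k A small large =
  subst₂ (λ q a → Bound q k l a) (count-except e) (sym (∣A∣≡∑χ A))
    (bound-from-counts {l = l} 2≤k nontrivial-total nontrivial-squares (cauchy-schwarz (δᶜ e) D))
  where
  open Differences G
  a : ℕ
  a = sum (χ A)
  D : Fin q → ℕ
  D = Representations.rep _-_ (χ A)
  nontrivial-total : ∑[ y < q ] (δᶜ e y * D y) + a ≡ a * a
  nontrivial-total = subst (λ s → ∑[ y < q ] (δᶜ e y * D y) + s ≡ a * a) (χ-idem A)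
                       (nontrivial-differences (χ A))
  nontrivial-squares : ∑[ y < q ] (δᶜ e y * (D y * D y)) + a * a ≤ k * (a * a) + l * (k + l) * a
  nontrivial-squares =
    subst (λ s → ∑[ y < q ] (δᶜ e y * (D y * D y)) + s * s ≤ k * (a * a) + l * (k + l) * a) (χ-idem A)
          (≤-trans (≤-reflexive (nontrivial-energy (χ A))) (energy-upper-bound _·_ A k l small large))
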